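{- For any finite simple connected graph $G$ on $n\geq 2$ vertices, $T(G)\leq \left\lceil \frac{n}{2}\right\rceil$.
   Context: A tree cover of a graph $G$ is a collection of vertex-disjoint simple trees, each occurring as an induced subgraph of $G$, whose union covers all vertices of $G$. The tree cover number $T(G)$ is the minimum cardinality of a tree cover of $G$. -}

module Defs where

open import Data.Nat using (ℕ; zero; suc; _≤_)
open import Data.Fin using (Fin; zero; suc; inject₁; fromℕ)
open import Data.Bool using (Bool; true; false)
open import Data.Product using (Σ; ∃; _×_; _,_)
open import Data.Unit using (⊤)
open import Data.Empty using (⊥)
open import Function.Definitions using (Injective; Surjective)
open import Relation.Binary.PropositionalEquality using (_≡_)
open import Relation.Nullary using (¬_)

record Graph (n : ℕ) : Set where
  field
    adj    : Fin n → Fin n → Bool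
    sym    : ∀ u v → adj u v ≡ adj v u
    irrefl : ∀ v → adj v v ≡ false

module _ {n : ℕ} (G : Graph n) where
  open Graph G

  Adj : Fin n → Fin n → Set
  Adj u v = adj u v ≡ true

  -- Reach P u v : there is a walk from u to v all of whose vertices satisfy P
  -- (i.e. a walk in the subgraph induced by P).
  data Reach (P : Fin n → Set) : Fin n → Fin n → Set where
    here : ∀ {v} → P v → Reach P v v
    step : ∀ {u w v} → P u → Adj u w → Reach P w v → Reach P u v

  Connected : Set
  Connected = ∀ u v → Reach (λ _ → ⊤) u v

  -- A cycle of length m+3 whose vertices all satisfy P: distinct vertices
  -- f 0, ..., f (m+2), consecutive ones adjacent, and f (m+2) adjacent to f 0.
  record CycleIn (P : Fin n → Set) : Set where
    field
      len  : ℕ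
      vert : Fin (suc (suc (suc len))) → Fin n
      inj  : Injective _≡_ _≡_ vert
      inP  : ∀ j → P (vert j)
      next : ∀ (j : Fin (suc (suc len))) → Adj (vert (inject₁ j)) (vert (suc j))
      close : Adj (vert (fromℕ (suc (suc len)))) (vert zero)

  InducedTree : (Fin n → Set) → Set
  InducedTree P = (Σ (Fin n) P)
                × (∀ u v → P u → P v → Reach P u v)
                × ¬ CycleIn P

  -- A tree cover with k trees: a partition of the vertices into k classes
  -- (class of v is colour v), each class inducing a (nonempty) tree.
  record TreeCover (k : ℕ) : Set where
    field
      colour : Fin n → Fin k
      trees  : ∀ (i : Fin k) → InducedTree (λ v → colour v ≡ i)

  -- T(G) ≤ m  iff some tree cover has at most m trees.
  TreeCoverNumber≤ : ℕ → Set
  TreeCoverNumber≤ m = Σ ℕ (λ k → TreeCover k × k ≤ m)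

module Submission where

-- Grow a depth-first search tree rooted at some vertex r, always extending from a deepest
-- vertex that still has an unvisited neighbour. Then no two children of a common parent are
-- adjacent: when the second child w of p is attached, an earlier child y adjacent to w would be
-- a deeper vertex with the unvisited neighbour w. Hence, for any vertex set C containing r and
-- the parent of every vertex outside C, attaching each vertex outside C to its parent partitions
-- the graph into |C| induced stars. The even-depth vertices form such a set, and so do the
-- odd-depth vertices together with r; if the former has more than ⌈n/2⌉ elements, the latter
-- has at most ⌊n/2⌋.

open import Defs
open import Data.Empty using (⊥)
open import Data.Fin using (Fin; zero; suc; _≟_)
open import Data.Fin.Properties using (suc-injective; any?)
open import Data.Fin.Subset
  using (Subset; inside; outside; ⊤; ∁; _∈_; _∉_; _∪_; ⁅_⁆; _⊂_; _⊃_; ∣_∣)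
open import Data.Fin.Subset.Induction using (Acc; acc; ⊃-wellFounded)
open import Data.Fin.Subset.Properties
  using ( _∈?_; ∈⊤; x∈⁅x⁆; x∈⁅y⁆⇒x≡y; x∈p∪q⁺; x∈p∪q⁻; x∉p⇒x∈∁p; x∉∁p⇒x∈p; ⊆-antisym; ⊆⊤
        ; ∣p∣≤n; ∣p∣≤∣x∷p∣; ∣∁p∣≡n∸∣p∣; ∣⁅x⁆∣≡1)
open import Data.Nat using (ℕ; zero; suc; _+_; _∸_; _≤_; _<_; _≤?_; s≤s; parity; ⌊_/2⌋; ⌈_/2⌉)
open import Data.Nat.Properties
  using ( ≤-refl; ≤-reflexive; ≤-trans; ≰⇒≥; ≰⇒>; <⇒≱; +-suc; +-assoc; +-monoʳ-≤; +-cancelʳ-≤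
        ; m+[n∸m]≡n; ⌊n/2⌋≤⌈n/2⌉; ⌊n/2⌋+⌈n/2⌉≡n; module ≤-Reasoning)
open import Data.Parity.Base using (0ℙ; 1ℙ; _⁻¹)
open import Data.Parity.Properties using (suc-homo-⁻¹) renaming (_≟_ to _≟ℙ_)
open import Data.Product using (∃; _×_; _,_)
open import Data.Sum using (_⊎_; inj₁; inj₂)
open import Data.Vec using ([]; _∷_; here; there; tabulate)
open import Data.Vec.Functional using (updateAt)
open import Data.Vec.Functional.Properties using (updateAt-updates; updateAt-minimal)
open import Data.Vec.Properties using (lookup∘tabulate; []=⇒lookup; lookup⇒[]=)
open import Data.Bool using (true)
import Data.Bool.Properties as Bool
open import Function.Base using (_∘_; const)
open import Function.Definitions using (Injective)
open import Level using (Level)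
open import Relation.Binary.PropositionalEquality
  using (_≡_; _≢_; refl; sym; trans; cong; subst; module ≡-Reasoning)
open import Relation.Nullary using (¬_; does; yes; no; contradiction)
open import Relation.Nullary.Decidable using (dec-true; _×-dec_; ¬?)
open import Relation.Unary using (Pred; Decidable)

private
  variable
    n : ℕ
    ℓ : Level

∣p∪q∣≤∣p∣+∣q∣ : ∀ (p q : Subset n) → ∣ p ∪ q ∣ ≤ ∣ p ∣ + ∣ q ∣
∣p∪q∣≤∣p∣+∣q∣ [] [] = ≤-refl
∣p∪q∣≤∣p∣+∣q∣ (outside ∷ p) (outside ∷ q) = ∣p∪q∣≤∣p∣+∣q∣ p q
∣p∪q∣≤∣p∣+∣q∣ (outside ∷ p) (inside ∷ q) =
  ≤-trans (s≤s (∣p∪q∣≤∣p∣+∣q∣ p q)) (≤-reflexive (sym (+-suc ∣ p ∣ ∣ q ∣)))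
∣p∪q∣≤∣p∣+∣q∣ (inside ∷ p) (s ∷ q) =
  s≤s (≤-trans (∣p∪q∣≤∣p∣+∣q∣ p q) (+-monoʳ-≤ ∣ p ∣ (∣p∣≤∣x∷p∣ s q)))

∣p∣+∣∁p∣≡n : ∀ (p : Subset n) → ∣ p ∣ + ∣ ∁ p ∣ ≡ n
∣p∣+∣∁p∣≡n {n} p = begin
  ∣ p ∣ + ∣ ∁ p ∣   ≡⟨ cong (∣ p ∣ +_) (∣∁p∣≡n∸∣p∣ p) ⟩
  ∣ p ∣ + (n ∸ ∣ p ∣) ≡⟨ m+[n∸m]≡n (∣p∣≤n p) ⟩
  n                 ∎
  where open ≡-Reasoning

enumerate : (p : Subset n) → Fin ∣ p ∣ → Fin n
enumerate (inside ∷ p) zero = zero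
enumerate (inside ∷ p) (suc i) = suc (enumerate p i)
enumerate (outside ∷ p) i = suc (enumerate p i)

enumerate-∈ : ∀ (p : Subset n) i → enumerate p i ∈ p
enumerate-∈ (inside ∷ p) zero = here
enumerate-∈ (inside ∷ p) (suc i) = there (enumerate-∈ p i)
enumerate-∈ (outside ∷ p) i = there (enumerate-∈ p i)

enumerate-injective : ∀ (p : Subset n) → Injective _≡_ _≡_ (enumerate p)
enumerate-injective (inside ∷ p) {zero} {zero} _ = refl
enumerate-injective (inside ∷ p) {suc i} {suc j} e = cong suc (enumerate-injective p (suc-injective e))
enumerate-injective (outside ∷ p) e = enumerate-injective p (suc-injective e)

index : ∀ {p : Subset n} {x} → x ∈ p → Fin ∣ p ∣
index {p = inside ∷ p} here = zero
index {p = inside ∷ p} (there x∈p) = suc (index x∈p)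
index {p = outside ∷ p} (there x∈p) = index x∈p

enumerate-index : ∀ {p : Subset n} {x} (x∈p : x ∈ p) → enumerate p (index x∈p) ≡ x
enumerate-index {p = inside ∷ p} here = refl
enumerate-index {p = inside ∷ p} (there x∈p) = cong suc (enumerate-index x∈p)
enumerate-index {p = outside ∷ p} (there x∈p) = cong suc (enumerate-index x∈p)

subsetOf : {P : Pred (Fin n) ℓ} → Decidable P → Subset n
subsetOf P? = tabulate (does ∘ P?)

module _ {P : Pred (Fin n) ℓ} (P? : Decidable P) where

  ∈-subsetOf⁺ : ∀ {x} → P x → x ∈ subsetOf P?
  ∈-subsetOf⁺ {x} px = lookup⇒[]= x (subsetOf P?) (trans (lookup∘tabulate _ x) (dec-true (P? x) px))

  ∈-subsetOf⁻ : ∀ {x} → x ∈ subsetOf P? → P x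
  ∈-subsetOf⁻ {x} x∈ with P? x | trans (sym (lookup∘tabulate (does ∘ P?) x)) ([]=⇒lookup x∈)
  ... | yes px | _  = px
  ... | no _   | ()

m+n≡o⇒⌈o/2⌉<n⇒m+1≤⌈o/2⌉ : ∀ {m n o} → m + n ≡ o → ⌈ o /2⌉ < n → m + 1 ≤ ⌈ o /2⌉
m+n≡o⇒⌈o/2⌉<n⇒m+1≤⌈o/2⌉ {m} {n} {o} m+n≡o ⌈o/2⌉<n =
  ≤-trans (+-cancelʳ-≤ ⌈ o /2⌉ (m + 1) ⌊ o /2⌋ m+1+⌈o/2⌉≤⌊o/2⌋+⌈o/2⌉) (⌊n/2⌋≤⌈n/2⌉ o)
  where
    open ≤-Reasoning
    m+1+⌈o/2⌉≤⌊o/2⌋+⌈o/2⌉ : m + 1 + ⌈ o /2⌉ ≤ ⌊ o /2⌋ + ⌈ o /2⌉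
    m+1+⌈o/2⌉≤⌊o/2⌋+⌈o/2⌉ = begin
      m + 1 + ⌈ o /2⌉   ≡⟨ +-assoc m 1 ⌈ o /2⌉ ⟩
      m + suc ⌈ o /2⌉   ≤⟨ +-monoʳ-≤ m ⌈o/2⌉<n ⟩
      m + n             ≡⟨ m+n≡o ⟩
      o                 ≡⟨ ⌊n/2⌋+⌈n/2⌉≡n o ⟨
      ⌊ o /2⌋ + ⌈ o /2⌉ ∎

argmax : ∀ {P : Pred (Fin n) ℓ} → Decidable P → (f : Fin n → ℕ) →
         (∀ x → ¬ P x) ⊎ ∃ λ m → P m × ∀ y → P y → f y ≤ f m
argmax {zero}  P? f = inj₁ λ ()
argmax {suc n} P? f with argmax (P? ∘ suc) (f ∘ suc) | P? zero
... | inj₁ none | no ¬p₀ = inj₁ λ { zero → ¬p₀ ; (suc x) → none x }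
... | inj₁ none | yes p₀ =
  inj₂ (zero , p₀ , λ { zero _ → ≤-refl ; (suc y) py → contradiction py (none y) })
... | inj₂ (m , pm , max) | no ¬p₀ =
  inj₂ (suc m , pm , λ { zero p₀ → contradiction p₀ ¬p₀ ; (suc y) py → max y py })
... | inj₂ (m , pm , max) | yes p₀ with f zero ≤? f (suc m)
...   | yes f₀≤ = inj₂ (suc m , pm , λ { zero _ → f₀≤ ; (suc y) py → max y py })
...   | no  f₀≰ = inj₂ (zero , p₀ , λ { zero _ → ≤-refl ; (suc y) py → ≤-trans (max y py) (≰⇒≥ f₀≰) })

module _ (G : Graph n) where
  open Graph G using (adj) renaming (sym to adj-sym; irrefl to adj-irrefl)

  Adj-sym : ∀ {u v} → Adj G u v → Adj G v u
  Adj-sym {u} {v} uv = trans (adj-sym v u) uv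

  Adj⇒≢ : ∀ {u v} → Adj G u v → u ≢ v
  Adj⇒≢ {u} uu refl = contradiction (trans (sym uu) (adj-irrefl u)) λ ()

  module _ {P : Fin n → Set} {c : Fin n} (Pc : P c)
           (spoke : ∀ {v} → P v → v ≢ c → Adj G v c)
           (leaves-indep : ∀ {x y} → P x → P y → x ≢ c → y ≢ c → x ≢ y → ¬ Adj G x y) where

    leaf-neighbour≡centre : ∀ {x y} → P x → P y → x ≢ c → Adj G x y → y ≡ c
    leaf-neighbour≡centre {y = y} Px Py x≢c xy with y ≟ c
    ... | yes y≡c = y≡c
    ... | no  y≢c = contradiction xy (leaves-indep Px Py x≢c y≢c (Adj⇒≢ xy))

    no-nonbacktracking-walk₃ : ∀ {u₀ u₁ u₂ u₃} → P u₀ → P u₁ → P u₂ → P u₃ →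
      Adj G u₀ u₁ → Adj G u₁ u₂ → Adj G u₂ u₃ → u₀ ≢ u₂ → u₁ ≢ u₃ → ⊥
    no-nonbacktracking-walk₃ {u₁ = u₁} P₀ P₁ P₂ P₃ a₀₁ a₁₂ a₂₃ u₀≢u₂ u₁≢u₃ with u₁ ≟ c
    ... | no  u₁≢c = u₀≢u₂ (trans (leaf-neighbour≡centre P₁ P₀ u₁≢c (Adj-sym a₀₁))
                                  (sym (leaf-neighbour≡centre P₁ P₂ u₁≢c a₁₂)))
    ... | yes refl = u₁≢u₃ (sym (leaf-neighbour≡centre P₂ P₃ (Adj⇒≢ (Adj-sym a₁₂)) a₂₃))

    star-acyclic : ¬ CycleIn G P
    star-acyclic record { len = zero ; inj = inj ; inP = inP ; next = next ; close = close } =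
      no-nonbacktracking-walk₃ (inP _) (inP _) (inP _) (inP _) (next zero) (next (suc zero)) close
        (λ e → contradiction (inj e) λ ()) (λ e → contradiction (inj e) λ ())
    star-acyclic record { len = suc _ ; inj = inj ; inP = inP ; next = next } =
      no-nonbacktracking-walk₃ (inP _) (inP _) (inP _) (inP _)
        (next zero) (next (suc zero)) (next (suc (suc zero)))
        (λ e → contradiction (inj e) λ ()) (λ e → contradiction (inj e) λ ())

    reach-from-centre : ∀ {v} → P v → Reach G P c v
    reach-from-centre {v} Pv with v ≟ c
    ... | yes refl = here Pc
    ... | no  v≢c  = step Pc (Adj-sym (spoke Pv v≢c)) (here Pv)

    star-connected : ∀ u v → P u → P v → Reach G P u v
    star-connected u v Pu Pv with u ≟ c
    ... | yes refl = reach-from-centre Pv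
    ... | no  u≢c  = step Pu (spoke Pu u≢c) (reach-from-centre Pv)

    star⇒InducedTree : InducedTree G P
    star⇒InducedTree = (c , Pc) , star-connected , star-acyclic

  module _ (C : Subset n) (attach : Fin n → Fin n)
           (attach∈ : ∀ {v} → v ∉ C → attach v ∈ C)
           (attach-adj : ∀ {v} → v ∉ C → Adj G v (attach v))
           (leaves-indep : ∀ {x y} → x ∉ C → y ∉ C → x ≢ y → attach x ≡ attach y → ¬ Adj G x y) where

    centreOf : Fin n → Fin n
    centreOf v with v ∈? C
    ... | yes _ = v
    ... | no  _ = attach v

    centreOf∈ : ∀ v → centreOf v ∈ C
    centreOf∈ v with v ∈? C
    ... | yes v∈ = v∈
    ... | no  v∉ = attach∈ v∉

    centreOf-∈ : ∀ {v} → v ∈ C → centreOf v ≡ v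
    centreOf-∈ {v} v∈ with v ∈? C
    ... | yes _  = refl
    ... | no  v∉ = contradiction v∈ v∉

    centreOf-∉ : ∀ {v} → v ∉ C → centreOf v ≡ attach v
    centreOf-∉ {v} v∉ with v ∈? C
    ... | yes v∈ = contradiction v∈ v∉
    ... | no  _  = refl

    colour : Fin n → Fin ∣ C ∣
    colour v = index (centreOf∈ v)

    colour≡⇒centreOf≡ : ∀ v {i} → colour v ≡ i → centreOf v ≡ enumerate C i
    colour≡⇒centreOf≡ v refl = sym (enumerate-index (centreOf∈ v))

    centreOf≡⇒colour≡ : ∀ v {i} → centreOf v ≡ enumerate C i → colour v ≡ i
    centreOf≡⇒colour≡ v e = enumerate-injective C (trans (enumerate-index (centreOf∈ v)) e)

    class-tree : ∀ i → InducedTree G (λ v → colour v ≡ i)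
    class-tree i = star⇒InducedTree centre-in-class spoke leaves-indep′
      where
        c = enumerate C i

        centre-in-class : colour c ≡ i
        centre-in-class = centreOf≡⇒colour≡ c (centreOf-∈ (enumerate-∈ C i))

        leaf∉C : ∀ v → colour v ≡ i → v ≢ c → v ∉ C
        leaf∉C v v∈class v≢c v∈ = v≢c (trans (sym (centreOf-∈ v∈)) (colour≡⇒centreOf≡ v v∈class))

        leaf-attach : ∀ v → colour v ≡ i → v ≢ c → attach v ≡ c
        leaf-attach v v∈class v≢c = trans (sym (centreOf-∉ (leaf∉C v v∈class v≢c))) (colour≡⇒centreOf≡ v v∈class)

        spoke : ∀ {v} → colour v ≡ i → v ≢ c → Adj G v c
        spoke {v} v∈class v≢c = subst (Adj G v) (leaf-attach v v∈class v≢c) (attach-adj (leaf∉C v v∈class v≢c))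

        leaves-indep′ : ∀ {x y} → colour x ≡ i → colour y ≡ i → x ≢ c → y ≢ c → x ≢ y → ¬ Adj G x y
        leaves-indep′ {x} {y} x∈class y∈class x≢c y≢c x≢y =
          leaves-indep (leaf∉C x x∈class x≢c) (leaf∉C y y∈class y≢c) x≢y
            (trans (leaf-attach x x∈class x≢c) (sym (leaf-attach y y∈class y≢c)))

    starCover : TreeCover G ∣ C ∣
    starCover = record { colour = colour ; trees = class-tree }

  record SearchTree (r : Fin n) (S : Subset n) : Set where
    field
      parent       : Fin n → Fin n
      depth        : Fin n → ℕ
      root∈        : r ∈ S
      depth-root   : depth r ≡ 0
      parent∈      : ∀ {v} → v ∈ S → v ≢ r → parent v ∈ S
      parent-adj   : ∀ {v} → v ∈ S → v ≢ r → Adj G v (parent v)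
      depth-parent : ∀ {v} → v ∈ S → v ≢ r → depth v ≡ suc (depth (parent v))
      siblings-nonadjacent : ∀ {x y} → x ∈ S → y ∈ S → x ≢ r → y ≢ r → x ≢ y →
                             parent x ≡ parent y → ¬ Adj G x y

  Frontier : Subset n → Fin n → Set
  Frontier S v = v ∈ S × ∃ λ w → w ∉ S × Adj G v w

  frontier? : ∀ S → Decidable (Frontier S)
  frontier? S v = v ∈? S ×-dec any? (λ w → ¬? (w ∈? S) ×-dec (adj v w Bool.≟ true))

  module Extend {r S} (T : SearchTree r S) {p w} (p∈ : p ∈ S) (w∉ : w ∉ S) (pw : Adj G p w)
                (deepest : ∀ y → Frontier S y → SearchTree.depth T y ≤ SearchTree.depth T p) where
    open SearchTree T

    S′ : Subset n
    S′ = ⁅ w ⁆ ∪ S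

    parent′ : Fin n → Fin n
    parent′ = updateAt parent w (const p)

    depth′ : Fin n → ℕ
    depth′ = updateAt depth w (const (suc (depth p)))

    ∈S⇒≢w : ∀ {x} → x ∈ S → x ≢ w
    ∈S⇒≢w x∈ refl = w∉ x∈

    ∈S′⁺ : ∀ {x} → x ∈ S → x ∈ S′
    ∈S′⁺ x∈ = x∈p∪q⁺ (inj₂ x∈)

    ∈S′⁻ : ∀ {x} → x ∈ S′ → x ≡ w ⊎ x ∈ S
    ∈S′⁻ x∈ with x∈p∪q⁻ ⁅ w ⁆ S x∈
    ... | inj₁ x∈⁅w⁆ = inj₁ (x∈⁅y⁆⇒x≡y w x∈⁅w⁆)
    ... | inj₂ x∈S   = inj₂ x∈S

    parent′-w : parent′ w ≡ p
    parent′-w = updateAt-updates w parent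

    depth′-w : depth′ w ≡ suc (depth p)
    depth′-w = updateAt-updates w depth

    parent′-S : ∀ {x} → x ∈ S → parent′ x ≡ parent x
    parent′-S x∈ = updateAt-minimal _ w parent (∈S⇒≢w x∈)

    depth′-S : ∀ {x} → x ∈ S → depth′ x ≡ depth x
    depth′-S x∈ = updateAt-minimal _ w depth (∈S⇒≢w x∈)

    child-of-p-not-adjacent-to-w : ∀ {y} → y ∈ S → y ≢ r → parent y ≡ p → ¬ Adj G y w
    child-of-p-not-adjacent-to-w {y} y∈ y≢r py≡p yw =
      <⇒≱ p<y (deepest y (y∈ , w , w∉ , yw))
      where
        p<y : depth p < depth y
        p<y = ≤-reflexive (sym (trans (depth-parent y∈ y≢r) (cong (suc ∘ depth) py≡p)))

    parent∈′ : ∀ {v} → v ∈ S′ → v ≢ r → parent′ v ∈ S′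
    parent∈′ v∈ v≢r with ∈S′⁻ v∈
    ... | inj₁ refl rewrite parent′-w = ∈S′⁺ p∈
    ... | inj₂ v∈S  rewrite parent′-S v∈S = ∈S′⁺ (parent∈ v∈S v≢r)

    parent-adj′ : ∀ {v} → v ∈ S′ → v ≢ r → Adj G v (parent′ v)
    parent-adj′ v∈ v≢r with ∈S′⁻ v∈
    ... | inj₁ refl rewrite parent′-w = Adj-sym pw
    ... | inj₂ v∈S  rewrite parent′-S v∈S = parent-adj v∈S v≢r

    depth-parent′ : ∀ {v} → v ∈ S′ → v ≢ r → depth′ v ≡ suc (depth′ (parent′ v))
    depth-parent′ v∈ v≢r with ∈S′⁻ v∈
    ... | inj₁ refl rewrite parent′-w | depth′-w | depth′-S p∈ = refl
    ... | inj₂ v∈S  rewrite parent′-S v∈S | depth′-S v∈S | depth′-S (parent∈ v∈S v≢r) =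
      depth-parent v∈S v≢r

    siblings-nonadjacent′ : ∀ {x y} → x ∈ S′ → y ∈ S′ → x ≢ r → y ≢ r → x ≢ y →
                            parent′ x ≡ parent′ y → ¬ Adj G x y
    siblings-nonadjacent′ x∈ y∈ x≢r y≢r x≢y same with ∈S′⁻ x∈ | ∈S′⁻ y∈
    ... | inj₁ refl | inj₁ refl = contradiction refl x≢y
    ... | inj₁ refl | inj₂ y∈S  = child-of-p-not-adjacent-to-w y∈S y≢r
      (trans (sym (parent′-S y∈S)) (trans (sym same) parent′-w)) ∘ Adj-sym
    ... | inj₂ x∈S  | inj₁ refl = child-of-p-not-adjacent-to-w x∈S x≢r
      (trans (sym (parent′-S x∈S)) (trans same parent′-w))
    ... | inj₂ x∈S  | inj₂ y∈S  = siblings-nonadjacent x∈S y∈S x≢r y≢r x≢y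
      (trans (sym (parent′-S x∈S)) (trans same (parent′-S y∈S)))

    tree : SearchTree r S′
    tree = record
      { parent = parent′ ; depth = depth′ ; root∈ = ∈S′⁺ root∈
      ; depth-root = trans (depth′-S root∈) depth-root
      ; parent∈ = parent∈′ ; parent-adj = parent-adj′ ; depth-parent = depth-parent′
      ; siblings-nonadjacent = siblings-nonadjacent′ }

    grows : S ⊂ S′
    grows = ∈S′⁺ , w , x∈p∪q⁺ (inj₁ (x∈⁅x⁆ w)) , w∉

  singletonTree : ∀ r → SearchTree r ⁅ r ⁆
  singletonTree r = record
    { parent = λ v → v ; depth = const 0 ; root∈ = x∈⁅x⁆ r ; depth-root = refl
    ; parent∈ = only-root ; parent-adj = only-root ; depth-parent = only-root
    ; siblings-nonadjacent = λ x∈ _ → only-root x∈ }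
    where
      only-root : ∀ {A : Set} {v} → v ∈ ⁅ r ⁆ → v ≢ r → A
      only-root v∈ v≢r = contradiction (x∈⁅y⁆⇒x≡y r v∈) v≢r

  no-frontier⇒spanning : Connected G → ∀ {r S} → r ∈ S → (∀ v → ¬ Frontier S v) → ∀ v → v ∈ S
  no-frontier⇒spanning conn {r} {S} r∈ none v = walk-stays-in-S (conn r v) r∈
    where
      walk-stays-in-S : ∀ {u v} → Reach G _ u v → u ∈ S → v ∈ S
      walk-stays-in-S (here _)             u∈ = u∈
      walk-stays-in-S (step {u} {x} _ ux rest) u∈ with x ∈? S
      ... | yes x∈ = walk-stays-in-S rest x∈
      ... | no  x∉ = contradiction (u∈ , x , x∉ , ux) (none u)

  module _ (conn : Connected G) {r : Fin n} where

    grow : ∀ {S} → SearchTree r S → Acc _⊃_ S → SearchTree r ⊤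
    grow {S} T (acc more) with argmax (frontier? S) (SearchTree.depth T)
    ... | inj₁ none = subst (SearchTree r) S≡⊤ T
      where
        S≡⊤ : S ≡ ⊤
        S≡⊤ = ⊆-antisym ⊆⊤ λ {v} _ → no-frontier⇒spanning conn (SearchTree.root∈ T) none v
    ... | inj₂ (p , (p∈ , w , w∉ , pw) , deepest) =
      grow (Extend.tree T p∈ w∉ pw deepest) (more (Extend.grows T p∈ w∉ pw deepest))

  spanningSearchTree : Connected G → ∀ r → SearchTree r ⊤
  spanningSearchTree conn r = grow conn (singletonTree r) (⊃-wellFounded _)

  module _ {r : Fin n} (T : SearchTree r ⊤) where
    open SearchTree T

    treeCover : (C : Subset n) → r ∈ C → (∀ {v} → v ∉ C → parent v ∈ C) → TreeCover G ∣ C ∣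
    treeCover C r∈C closed = starCover C parent closed
      (λ v∉ → parent-adj ∈⊤ (∉⇒≢r v∉))
      (λ x∉ y∉ → siblings-nonadjacent ∈⊤ ∈⊤ (∉⇒≢r x∉) (∉⇒≢r y∉))
      where
        ∉⇒≢r : ∀ {v} → v ∉ C → v ≢ r
        ∉⇒≢r v∉ refl = v∉ r∈C

    odd? : Decidable (λ v → parity (depth v) ≡ 1ℙ)
    odd? v = parity (depth v) ≟ℙ 1ℙ

    Odd : Subset n
    Odd = subsetOf odd?

    r∉Odd : r ∉ Odd
    r∉Odd r∈ with trans (sym (cong parity depth-root)) (∈-subsetOf⁻ odd? r∈)
    ... | ()

    parity-parent : ∀ {v} → v ≢ r → parity (depth (parent v)) ≡ parity (depth v) ⁻¹
    parity-parent {v} v≢r = begin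
      parity (depth (parent v))           ≡⟨ sym (suc-homo-⁻¹ (depth (parent v))) ⟩
      parity (suc (depth (parent v))) ⁻¹  ≡⟨ cong (λ d → parity d ⁻¹) (sym (depth-parent ∈⊤ v≢r)) ⟩
      parity (depth v) ⁻¹                 ∎
      where open ≡-Reasoning

    parent∉Odd : ∀ {v} → v ≢ r → v ∈ Odd → parent v ∉ Odd
    parent∉Odd v≢r v∈ pv∈
      with trans (sym (∈-subsetOf⁻ odd? pv∈)) (trans (parity-parent v≢r) (cong _⁻¹ (∈-subsetOf⁻ odd? v∈)))
    ... | ()

    parent∈Odd : ∀ {v} → v ≢ r → v ∉ Odd → parent v ∈ Odd
    parent∈Odd {v} v≢r v∉ = ∈-subsetOf⁺ odd? (trans (parity-parent v≢r) (even⁻¹ (v∉ ∘ ∈-subsetOf⁺ odd?)))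
      where
        even⁻¹ : ∀ {q} → q ≢ 1ℙ → q ⁻¹ ≡ 1ℙ
        even⁻¹ {0ℙ} _   = refl
        even⁻¹ {1ℙ} q≢1 = contradiction refl q≢1

    smallerClassCover : TreeCoverNumber≤ G ⌈ n /2⌉
    smallerClassCover with ∣ ∁ Odd ∣ ≤? ⌈ n /2⌉
    ... | yes even-small = ∣ ∁ Odd ∣ , treeCover (∁ Odd) (x∉p⇒x∈∁p r∉Odd) even-closed , even-small
      where
        even-closed : ∀ {v} → v ∉ ∁ Odd → parent v ∈ ∁ Odd
        even-closed {v} v∉ = x∉p⇒x∈∁p (parent∉Odd v≢r v∈Odd)
          where
            v∈Odd = x∉∁p⇒x∈p v∉
            v≢r : v ≢ r
            v≢r refl = r∉Odd v∈Odd
    ... | no even-large = ∣ Odd ∪ ⁅ r ⁆ ∣ , treeCover (Odd ∪ ⁅ r ⁆) r∈ odd-closed , bound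
      where
        r∈ : r ∈ Odd ∪ ⁅ r ⁆
        r∈ = x∈p∪q⁺ (inj₂ (x∈⁅x⁆ r))

        odd-closed : ∀ {v} → v ∉ Odd ∪ ⁅ r ⁆ → parent v ∈ Odd ∪ ⁅ r ⁆
        odd-closed {v} v∉ = x∈p∪q⁺ (inj₁ (parent∈Odd v≢r (v∉ ∘ x∈p∪q⁺ ∘ inj₁)))
          where
            v≢r : v ≢ r
            v≢r refl = v∉ r∈

        bound : ∣ Odd ∪ ⁅ r ⁆ ∣ ≤ ⌈ n /2⌉
        bound = begin
          ∣ Odd ∪ ⁅ r ⁆ ∣     ≤⟨ ∣p∪q∣≤∣p∣+∣q∣ Odd ⁅ r ⁆ ⟩
          ∣ Odd ∣ + ∣ ⁅ r ⁆ ∣ ≡⟨ cong (∣ Odd ∣ +_) (∣⁅x⁆∣≡1 r) ⟩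
          ∣ Odd ∣ + 1         ≤⟨ m+n≡o⇒⌈o/2⌉<n⇒m+1≤⌈o/2⌉ (∣p∣+∣∁p∣≡n Odd) (≰⇒> even-large) ⟩
          ⌈ n /2⌉             ∎
          where open ≤-Reasoning

mainTheorem3 : ∀ (n : ℕ) → 2 ≤ n → (G : Graph n) → Connected G
               → TreeCoverNumber≤ G ⌈ n /2⌉
mainTheorem3 zero    ()  _ _
mainTheorem3 (suc _) _ G conn = smallerClassCover G (spanningSearchTree G conn zero)
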